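{- Let $\Pi$ be a linear $m$-scheme on $S\subseteq V$, $t\in[m-1]$ and $x\in S^t$. Then $\mathcal{B}(\Pi^{(1)})\subseteq\mathcal{B}(\Pi_x^{(1)})$, i.e., the partition $\Pi_x^{(1)}$ refines $\Pi^{(1)}$.
   Context: $V$ is a finite-dimensional vector space over a finite field $\mathbb{F}$. $\mathcal{M}_{k,k'}$ is the set of maps $V^k\to V^{k'}$, $(x_1,\dots,x_k)\mapsto(\sum_i c_{i,1}x_i,\dots,\sum_i c_{i,k'}x_i)$, $c_{i,j}\in\mathbb{F}$. A linear $m$-scheme on $S$ is $\Pi=\{\Pi^{(1)},\dots,\Pi^{(m)}\}$ with $\Pi^{(k)}$ a partition of $S^k$ such that for all $k,k'\in[m]$, $B\in\Pi^{(k)}$, $B'\in\Pi^{(k')}$, $\tau\in\mathcal{M}_{k,k'}$: (P1) $\tau(B)=B'$ or $\tau(B)\cap B'=\emptyset$; (P2) $\#\{x\in B:\tau(x)=y\}$ is constant for $y\in B'$. For $x\in S^t$, $\Pi_x^{(k)}$ ($k\in[m-t]$) is the partition of $S^k$ in which $y,z$ are in the same block iff $(x,y),(x,z)$ are in the same block of $\Pi^{(t+k)}$. For a set $P$ of subsets of $S$, $\mathcal{B}(P)$ is the set of subsets of $S$ that are unions of members of $P$. -}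

module Defs where

open import Data.Nat using (ℕ; zero; suc; _≤_)
import Data.Nat as ℕ
import Data.Nat.Properties as ℕₚ
open import Data.Fin using (Fin)
open import Data.Bool using (Bool; true; false; _∧_)
open import Data.Vec using (Vec; []; _∷_; _++_; foldr)
import Data.Vec as Vec
open import Data.Vec.Properties using (≡-dec)
open import Data.List using (List; []; _∷_; length; filter; concatMap; map)
open import Data.List.Membership.Propositional using (_∈_)
open import Data.List.Relation.Unary.Unique.Propositional using (Unique)
open import Data.Product using (Σ; _×_; _,_; ∃)
open import Data.Sum using (_⊎_)
open import Relation.Nullary using (¬_; Dec; yes; no)
open import Relation.Nullary.Decidable using (⌊_⌋)
open import Relation.Binary.PropositionalEquality using (_≡_; _≢_)
open import Relation.Binary.Definitions using (DecidableEquality)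
open import Algebra.Structures using (IsCommutativeRing)
open import Function.Bundles using (_⇔_)

record FiniteField : Set₁ where
  infixl 6 _+_
  infixl 7 _*_
  field
    Carrier  : Set
    _+_ _*_  : Carrier → Carrier → Carrier
    -_       : Carrier → Carrier
    0# 1#    : Carrier
    isCommutativeRing : IsCommutativeRing _≡_ _+_ _*_ -_ 0# 1#
    0≢1      : 0# ≢ 1#
    inverse  : ∀ a → a ≢ 0# → Σ Carrier λ b → a * b ≡ 1#
    _≟_      : DecidableEquality Carrier
    elements : List Carrier
    elements-unique   : Unique elements
    elements-complete : ∀ a → a ∈ elements

record Partition (X : Set) (P : X → Bool) : Set₁ where
  field
    Block    : Set
    mem      : Block → X → Bool
    mem⊆     : ∀ b x → mem b x ≡ true → P x ≡ true
    nonempty : ∀ b → ∃ λ x → mem b x ≡ true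
    disjoint : ∀ b b' x → mem b x ≡ true → mem b' x ≡ true → b ≡ b'
    cover    : ∀ x → P x ≡ true → ∃ λ b → mem b x ≡ true

-- 𝓑(P): U is a union of members of the family fam
IsUnionOf : {X I : Set} → (I → X → Set) → (X → Set) → Set₁
IsUnionOf {X} {I} fam U =
  Σ (I → Set) λ C → ∀ x → U x ⇔ (∃ λ i → C i × fam i x)

allVecs : ∀ {A : Set} k → List A → List (Vec A k)
allVecs zero    as = [] ∷ []
allVecs (suc k) as = concatMap (λ a → map (a ∷_) (allVecs k as)) as

module _ (𝔽 : FiniteField) where
  open FiniteField 𝔽

  V : ℕ → Set
  V n = Vec Carrier n

  Tuple : ℕ → ℕ → Set
  Tuple n k = Vec (V n) k

  _≟V_ : ∀ {n} → DecidableEquality (V n)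
  _≟V_ = ≡-dec _≟_

  _≟T_ : ∀ {n k} → DecidableEquality (Tuple n k)
  _≟T_ = ≡-dec _≟V_

  allTuples : ∀ n k → List (Tuple n k)
  allTuples n k = allVecs k (allVecs n elements)

  count : ∀ n k → (Tuple n k → Bool) → ℕ
  count n k p = length (filter (λ x → p x Data.Bool.≟ true) (allTuples n k))

  _+V_ : ∀ {n} → V n → V n → V n
  _+V_ = Vec.zipWith _+_

  _·V_ : ∀ {n} → Carrier → V n → V n
  a ·V v = Vec.map (a *_) v

  0V : ∀ {n} → V n
  0V = Vec.replicate _ 0#

  -- the map τ_c ∈ M_{k,k'} with coefficients c i j:
  -- (x_1,…,x_k) ↦ (Σ_i c_{i,1} x_i , … , Σ_i c_{i,k'} x_i)
  linMap : ∀ {n k k'} → (Fin k → Fin k' → Carrier) → Tuple n k → Tuple n k'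
  linMap {n} {k} {k'} c x =
    Vec.tabulate λ j → foldr _ _+V_ 0V (Vec.tabulate λ i → c i j ·V Vec.lookup x i)

  InPow : ∀ {n} → (V n → Bool) → ∀ {k} → Tuple n k → Bool
  InPow S []       = true
  InPow S (v ∷ xs) = S v ∧ InPow S xs

  InImage : ∀ {n k k'} → (Tuple n k → Tuple n k') → (Tuple n k → Bool) → Tuple n k' → Set
  InImage τ B y = ∃ λ x → B x ≡ true × τ x ≡ y

  record LinearScheme (n : ℕ) (S : V n → Bool) (m : ℕ) : Set₁ where
    field
      Π : (k : ℕ) → 1 ≤ k → k ≤ m → Partition (Tuple n k) (InPow S)
    open Partition
    field
      P1 : ∀ k (1≤k : 1 ≤ k) (k≤m : k ≤ m) k' (1≤k' : 1 ≤ k') (k'≤m : k' ≤ m)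
           (B : Block (Π k 1≤k k≤m)) (B' : Block (Π k' 1≤k' k'≤m))
           (c : Fin k → Fin k' → Carrier) →
           (∀ y → InImage (linMap c) (mem (Π k 1≤k k≤m) B) y ⇔ (mem (Π k' 1≤k' k'≤m) B' y ≡ true))
           ⊎ (∀ y → InImage (linMap c) (mem (Π k 1≤k k≤m) B) y →
                    ¬ (mem (Π k' 1≤k' k'≤m) B' y ≡ true))
      P2 : ∀ k (1≤k : 1 ≤ k) (k≤m : k ≤ m) k' (1≤k' : 1 ≤ k') (k'≤m : k' ≤ m)
           (B : Block (Π k 1≤k k≤m)) (B' : Block (Π k' 1≤k' k'≤m))
           (c : Fin k → Fin k' → Carrier) →
           ∃ λ N → ∀ y → mem (Π k' 1≤k' k'≤m) B' y ≡ true →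
             count n k (λ x → mem (Π k 1≤k k≤m) B x ∧ ⌊ linMap c x ≟T y ⌋) ≡ N

  blocksOf : ∀ {X P} (Q : Partition X P) → Partition.Block Q → X → Set
  blocksOf Q b x = Partition.mem Q b x ≡ true

  SameBlock : ∀ {X P} → Partition X P → X → X → Set
  SameBlock Q y z = ∃ λ b → Partition.mem Q b y ≡ true × Partition.mem Q b z ≡ true

  -- Π_x^(k) for x ∈ S^t (ℕ._+_ t k ≤ m): the block of y ∈ S^k is
  -- { z ∈ S^k : (x,y) and (x,z) lie in the same block of Π^(t+k) }.
  -- Presented as a family indexed by the elements y ∈ S^k.
  PiX : ∀ {n S m} (Π : LinearScheme n S m) {t} (x : Tuple n t) k →
        1 ≤ k → ℕ._+_ t k ≤ m →
        (Σ (Tuple n k) λ y → InPow S y ≡ true) → Tuple n k → Set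
  PiX {S = S} Π {t} x k 1≤k tk≤m (y , _) z =
    InPow S z ≡ true ×
    SameBlock (LinearScheme.Π Π (ℕ._+_ t k) (ℕₚ.≤-trans 1≤k (+-monoʳ-≤' t)) tk≤m) (x ++ y) (x ++ z)
    where
    +-monoʳ-≤' : ∀ t → k ≤ ℕ._+_ t k
    +-monoʳ-≤' zero    = ℕₚ.≤-refl
    +-monoʳ-≤' (suc t) = ℕₚ.m≤n⇒m≤1+n (+-monoʳ-≤' t)

{-# OPTIONS --safe #-}
-- Projecting V^(t+1) onto its last coordinate is a map in M_{t+1,1}.  By (P1) it sends a block
-- of Π^(t+1) either onto a block of Π^(1) or off it, and (x,y) ↦ y hits the block of y; so
-- whenever (x,y) and (x,z) share a block of Π^(t+1), y and z share a block of Π^(1).  Hence a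
-- union of blocks of Π^(1) contains the whole block of Π_x^(1) through each of its points.
module Submission where

open import Defs
open import Data.Nat using (ℕ; zero; suc; _+_; _≤_)
open import Data.Nat.Properties using (≤-refl; ≤-trans; m≤n+m)
open import Data.Bool using (Bool; true)
open import Data.Fin using (Fin)
import Data.Fin as Fin
open import Data.Vec using ([]; _∷_; _++_)
import Data.Vec as Vec
open import Data.Product using (_×_; _,_; ∃)
open import Data.Sum using (inj₁; inj₂)
open import Data.Empty using (⊥-elim)
open import Function.Bundles using (mk⇔; Equivalence)
open import Relation.Binary.PropositionalEquality using (_≡_; refl; cong; cong₂; trans)
open import Algebra.Structures using (IsCommutativeRing)

covered⇒IsUnionOf : {X I : Set} (fam : I → X → Set) (U : X → Set) →
  (∀ x → U x → ∃ λ i → fam i x × (∀ z → fam i z → U z)) → IsUnionOf fam U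
covered⇒IsUnionOf fam U covered =
  (λ i → ∀ z → fam i z → U z) , λ x → mk⇔ (to x) (λ { (i , i⊆U , x∈i) → i⊆U x x∈i })
  where
  to : ∀ x → U x → ∃ λ i → (∀ z → fam i z → U z) × fam i x
  to x ux with covered x ux
  ... | i , x∈i , i⊆U = i , i⊆U , x∈i

module _ (𝔽 : FiniteField) where
  open FiniteField 𝔽 using (Carrier; 0#; 1#; isCommutativeRing)
  open IsCommutativeRing isCommutativeRing using (*-identityˡ; zeroˡ; +-identityˡ; +-identityʳ)

  SameBlock-refl : ∀ {X P} (Q : Partition X P) x → P x ≡ true → SameBlock 𝔽 Q x x
  SameBlock-refl Q x px with Partition.cover Q x px
  ... | b , x∈b = b , x∈b , x∈b

  IsUnionOf-blocks⊆ : ∀ {X P} (Q : Partition X P) {U : X → Set} →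
    IsUnionOf (blocksOf 𝔽 Q) U → ∀ x → U x → P x ≡ true
  IsUnionOf-blocks⊆ Q (_ , U⇔) x ux with Equivalence.to (U⇔ x) ux
  ... | b , _ , x∈b = Partition.mem⊆ Q b x x∈b

  IsUnionOf-SameBlock-closed : ∀ {X P} (Q : Partition X P) {U : X → Set} →
    IsUnionOf (blocksOf 𝔽 Q) U → ∀ {y z} → U y → SameBlock 𝔽 Q y z → U z
  IsUnionOf-SameBlock-closed Q {U} (C , U⇔) {y} {z} uy (b , y∈b , z∈b)
    with Equivalence.to (U⇔ y) uy
  ... | b' , Cb' , y∈b' with Partition.disjoint Q b b' y y∈b y∈b'
  ... | refl = Equivalence.from (U⇔ z) (b , Cb' , z∈b)

  InPow-++ : ∀ {n} (S : V 𝔽 n → Bool) {t k} (x : Tuple 𝔽 n t) (z : Tuple 𝔽 n k) →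
    InPow 𝔽 S x ≡ true → InPow 𝔽 S z ≡ true → InPow 𝔽 S (x ++ z) ≡ true
  InPow-++ S []      z _ z∈S = z∈S
  InPow-++ S (v ∷ x) z x∈S z∈S with S v | x∈S
  ... | true | x∈S' = InPow-++ S x z x∈S' z∈S

  InPow-++⁻ʳ : ∀ {n} (S : V 𝔽 n → Bool) {t k} (x : Tuple 𝔽 n t) (z : Tuple 𝔽 n k) →
    InPow 𝔽 S (x ++ z) ≡ true → InPow 𝔽 S z ≡ true
  InPow-++⁻ʳ S []      z xz∈S = xz∈S
  InPow-++⁻ʳ S (v ∷ x) z xz∈S with S v | xz∈S
  ... | true | xz∈S' = InPow-++⁻ʳ S x z xz∈S'

  ·V-identityˡ : ∀ {n} (v : V 𝔽 n) → _·V_ 𝔽 1# v ≡ v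
  ·V-identityˡ []      = refl
  ·V-identityˡ (a ∷ v) = cong₂ _∷_ (*-identityˡ a) (·V-identityˡ v)

  ·V-zeroˡ : ∀ {n} (v : V 𝔽 n) → _·V_ 𝔽 0# v ≡ 0V 𝔽
  ·V-zeroˡ []      = refl
  ·V-zeroˡ (a ∷ v) = cong₂ _∷_ (zeroˡ a) (·V-zeroˡ v)

  +V-identityˡ : ∀ {n} (v : V 𝔽 n) → _+V_ 𝔽 (0V 𝔽) v ≡ v
  +V-identityˡ []      = refl
  +V-identityˡ (a ∷ v) = cong₂ _∷_ (+-identityˡ a) (+V-identityˡ v)

  +V-identityʳ : ∀ {n} (v : V 𝔽 n) → _+V_ 𝔽 v (0V 𝔽) ≡ v
  +V-identityʳ []      = refl
  +V-identityʳ (a ∷ v) = cong₂ _∷_ (+-identityʳ a) (+V-identityʳ v)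

  lastCoord : ∀ t → Fin (t + 1) → Fin 1 → Carrier
  lastCoord zero    Fin.zero    _ = 1#
  lastCoord (suc t) Fin.zero    _ = 0#
  lastCoord (suc t) (Fin.suc i) j = lastCoord t i j

  linMap-lastCoord : ∀ {n} t (x : Tuple 𝔽 n t) (y : Tuple 𝔽 n 1) →
    linMap 𝔽 (lastCoord t) (x ++ y) ≡ y
  linMap-lastCoord t x (v ∷ []) = cong (_∷ []) (lastCoord-sum t x)
    where
    lastCoord-sum : ∀ t (x : Tuple 𝔽 _ t) →
      Vec.foldr _ (_+V_ 𝔽) (0V 𝔽)
        (Vec.tabulate λ i → _·V_ 𝔽 (lastCoord t i Fin.zero) (Vec.lookup (x ++ v ∷ []) i)) ≡ v
    lastCoord-sum zero    []      = trans (cong (λ w → _+V_ 𝔽 w (0V 𝔽)) (·V-identityˡ v)) (+V-identityʳ v)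
    lastCoord-sum (suc t) (u ∷ x) = trans (cong₂ (_+V_ 𝔽) (·V-zeroˡ u) (lastCoord-sum t x)) (+V-identityˡ v)

  module _ {n S m} (Π : LinearScheme 𝔽 n S m) where
    open LinearScheme Π using (P1) renaming (Π to Πᵏ)
    open Partition using (mem)

    image-meets⇒image⊆ : ∀ k (1≤k : 1 ≤ k) (k≤m : k ≤ m) k' (1≤k' : 1 ≤ k') (k'≤m : k' ≤ m) B B'
      (c : Fin k → Fin k' → Carrier) {y} →
      InImage 𝔽 (linMap 𝔽 c) (mem (Πᵏ k 1≤k k≤m) B) y → mem (Πᵏ k' 1≤k' k'≤m) B' y ≡ true →
      ∀ z → InImage 𝔽 (linMap 𝔽 c) (mem (Πᵏ k 1≤k k≤m) B) z → mem (Πᵏ k' 1≤k' k'≤m) B' z ≡ true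
    image-meets⇒image⊆ k 1≤k k≤m k' 1≤k' k'≤m B B' c y∈τB y∈B' with P1 k 1≤k k≤m k' 1≤k' k'≤m B B' c
    ... | inj₁ τB≡B'   = λ z → Equivalence.to (τB≡B' z)
    ... | inj₂ τB∩B'≡∅ = ⊥-elim (τB∩B'≡∅ _ y∈τB y∈B')

    SameBlock-suffix : ∀ {t} (1≤t+1 : 1 ≤ t + 1) (t+1≤m : t + 1 ≤ m) (1≤m : 1 ≤ m)
      (x : Tuple 𝔽 n t) {y z : Tuple 𝔽 n 1} →
      SameBlock 𝔽 (Πᵏ (t + 1) 1≤t+1 t+1≤m) (x ++ y) (x ++ z) → SameBlock 𝔽 (Πᵏ 1 ≤-refl 1≤m) y z
    SameBlock-suffix {t} 1≤t+1 t+1≤m 1≤m x {y} {z} (B , xy∈B , xz∈B)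
      with Partition.cover (Πᵏ 1 ≤-refl 1≤m) y y∈S
      where
      y∈S : InPow 𝔽 S y ≡ true
      y∈S = InPow-++⁻ʳ S x y (Partition.mem⊆ (Πᵏ (t + 1) 1≤t+1 t+1≤m) B (x ++ y) xy∈B)
    ... | b , y∈b =
      b , y∈b , image-meets⇒image⊆ (t + 1) 1≤t+1 t+1≤m 1 ≤-refl 1≤m B b (lastCoord t)
                  (x ++ y , xy∈B , linMap-lastCoord t x y) y∈b
                  z (x ++ z , xz∈B , linMap-lastCoord t x z)

lemma3p7 : (𝔽 : FiniteField) (n : ℕ) (S : V 𝔽 n → Bool) (m : ℕ)
    (Π : LinearScheme 𝔽 n S m) (t : ℕ) (1≤t : 1 ≤ t) (t+1≤m : t + 1 ≤ m)
    (x : Tuple 𝔽 n t) → InPow 𝔽 S x ≡ true →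
    (U : Tuple 𝔽 n 1 → Set) →
    IsUnionOf (blocksOf 𝔽 (LinearScheme.Π Π 1 ≤-refl (≤-trans (m≤n+m 1 t) t+1≤m))) U →
    IsUnionOf (PiX 𝔽 Π x 1 ≤-refl t+1≤m) U
lemma3p7 𝔽 n S m Π t _ t+1≤m x x∈S U U∈𝓑Π₁ =
  covered⇒IsUnionOf (PiX 𝔽 Π x 1 ≤-refl t+1≤m) U λ z z∈U →
    let z∈S = IsUnionOf-blocks⊆ 𝔽 Π₁ U∈𝓑Π₁ z z∈U in
    (z , z∈S) ,
    (z∈S , SameBlock-refl 𝔽 (LinearScheme.Π Π (t + 1) _ t+1≤m) (x ++ z) (InPow-++ 𝔽 S x z x∈S z∈S)) ,
    λ w (_ , xz∼xw) → IsUnionOf-SameBlock-closed 𝔽 Π₁ U∈𝓑Π₁ z∈U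
                        (SameBlock-suffix 𝔽 Π _ t+1≤m 1≤m x xz∼xw)
  where
  1≤m : 1 ≤ m
  1≤m = ≤-trans (m≤n+m 1 t) t+1≤m
  Π₁ : Partition (Tuple 𝔽 n 1) (InPow 𝔽 S)
  Π₁ = LinearScheme.Π Π 1 ≤-refl 1≤m
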